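{- Let $G$ be a graph of order $n$ and let $u,v$ be two vertices of $G$ of degree at least $\frac{n+1}{2}$. Then there exists a path in $G$ with endpoints $u$ and $v$ which contains all vertices of $G$ of degree at least $\frac{n+1}{2}$.
   Context: All graphs are finite, undirected, without loops or multiple edges. -}

module Defs where

open import Data.Nat using (ℕ; _+_; _*_; _≤_)
open import Data.Bool using (Bool; true; false; T)
open import Data.Fin using (Fin)
open import Data.List using (List; []; _∷_; filter; length)
open import Data.List.Base using (allFin)
open import Data.List.Relation.Unary.Unique.Propositional using (Unique)
open import Data.List.Membership.Propositional using (_∈_)
open import Data.Product using (_×_)
open import Relation.Binary.PropositionalEquality using (_≡_)
open import Relation.Nullary using (¬_)
open import Relation.Nullary.Decidable using (Dec)
open import Data.Bool.Properties using (T?)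

record Graph (n : ℕ) : Set where
  field
    adj      : Fin n → Fin n → Bool
    symmetric : ∀ x y → adj x y ≡ adj y x
    loopless  : ∀ x → adj x x ≡ false
open Graph public

degree : ∀ {n} → Graph n → Fin n → ℕ
degree {n} G x = length (filter (λ y → T? (adj G x y)) (allFin n))

HighDeg : ∀ {n} → Graph n → Fin n → Set
HighDeg {n} G x = n + 1 ≤ 2 * degree G x

data Walk {n : ℕ} (G : Graph n) : List (Fin n) → Set where
  walk-[]  : Walk G []
  walk-[x] : ∀ x → Walk G (x ∷ [])
  walk-∷   : ∀ x y {zs} → T (adj G x y) → Walk G (y ∷ zs) → Walk G (x ∷ y ∷ zs)

data Ends {A : Set} (u v : A) : List A → Set where
  ends-1 : u ≡ v → Ends u v (u ∷ [])
  ends-∷ : ∀ {y ys} → Ends y v (y ∷ ys) → Ends u v (u ∷ y ∷ ys)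

record Path {n : ℕ} (G : Graph n) (u v : Fin n) : Set where
  field
    vertices : List (Fin n)
    isWalk   : Walk G vertices
    distinct : Unique vertices
    ends     : Ends u v vertices
open Path public

{-# OPTIONS --safe #-}
-- Grow a path from u that avoids v, attaching the high-degree vertices one at a time and v last.
-- To attach a high-degree y to a path P from u to a high-degree x with x ≁ y: either x and y have
-- a common neighbour z ≠ v off P, and P z y is a path; or P has consecutive vertices p, q with
-- x ∼ p and y ∼ q, and the Pósa rotation u…p x…q followed by y is a path. Otherwise a neighbour
-- of x on P is never followed by a neighbour of y, so |N(x) ∩ P| + |N(y) ∩ P| ≤ |P|; y lies in
-- neither neighbourhood; and every other vertex off P except v lies in at most one of them.
-- Hence deg x + deg y ≤ n, contradicting deg x, deg y ≥ (n+1)/2.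
module Submission where

open import Defs
open import Data.Nat using (ℕ)
open import Data.Fin using (Fin)
open import Data.Product using (Σ)
open import Data.List.Membership.Propositional using (_∈_)
open import Relation.Binary.PropositionalEquality using (_≢_)

open import Algebra.Properties.CommutativeSemigroup using (interchange)
open import Data.Bool using (T)
open import Data.Bool.Properties using (T?)
open import Data.Empty using (⊥-elim)
open import Data.Fin.Properties using (_≟_; any?)
open import Data.List using (List; []; _∷_; _++_; _∷ʳ_; reverse; filter; length; drop; allFin)
open import Data.List.Membership.Propositional using (_∉_)
open import Data.List.Membership.Propositional.Properties
  using (∈-++⁺ˡ; ∈-++⁺ʳ; ∈-++⁻; ∈-filter⁺; ∈-filter⁻; ∈-allFin)
open import Data.List.Membership.Propositional.Properties.WithK using (unique∧set⇒bag)
open import Data.List.Properties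
  using (length-++; length-tabulate; filter-++; filter-reject; unfold-reverse; ++-assoc)
open import Data.List.Relation.Binary.BagAndSetEquality using (∼bag⇒↭)
open import Data.List.Relation.Binary.Permutation.Propositional
  using (_↭_; ↭-refl; ↭-sym; ↭-trans; ↭-reflexive; ↭⇒↭ₛ)
open import Data.List.Relation.Binary.Permutation.Propositional.Properties
  using (∈-resp-↭; ↭-length; ++⁺ˡ; ++⁺ʳ; ↭-reverse; filter-↭)
import Data.List.Relation.Binary.Permutation.Setoid.Properties as Setoid↭
open import Data.List.Relation.Unary.All as All using (All; []; _∷_)
open import Data.List.Relation.Unary.All.Properties using (¬Any⇒All¬)
open import Data.List.Relation.Unary.AllPairs using ([]; _∷_)
open import Data.List.Relation.Unary.Any using (here; there)
open import Data.List.Relation.Unary.Linked using (Linked; []; [-]; _∷_)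
open import Data.List.Relation.Unary.Unique.Propositional using (Unique)
import Data.List.Relation.Unary.Unique.Propositional.Properties as Unique
open import Data.Nat using (suc; _+_; _*_; _≤_; _<_; _≤?_; z≤n; s≤s)
open import Data.Nat.Properties
  using ( +-suc; +-identityʳ; +-comm; +-mono-≤; +-monoʳ-≤; ≤-trans; ≤-reflexive; m≤n⇒m≤1+n
        ; *-cancelˡ-≤; *-distribˡ-+; <⇒≱; +-commutativeSemigroup; module ≤-Reasoning)
open import Data.Product using (_×_; _,_; proj₂)
open import Data.Sum using (_⊎_; inj₁; inj₂)
import Data.Sum as Sum
open import Function using (id; _∘_)
open import Function.Bundles using (mk⇔)
open import Relation.Binary using (Rel)
import Relation.Binary as B
open import Relation.Binary.PropositionalEquality
  using (_≡_; refl; sym; trans; cong; cong₂; subst; subst₂; setoid; ≢-sym; resp₂; module ≡-Reasoning)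
open import Relation.Nullary using (¬_; yes; no; ¬?)
open import Relation.Nullary.Decidable using (_×-dec_; decidable-stable)
open import Relation.Unary using (Pred; Decidable)
open import Relation.Unary.Properties using (_∩?_)

Unique-resp-↭ : {A : Set} {xs ys : List A} → xs ↭ ys → Unique xs → Unique ys
Unique-resp-↭ {A} xs↭ys = Setoid↭.AllPairs-resp-↭ (setoid A) ≢-sym (resp₂ _) (↭⇒↭ₛ xs↭ys)

Unique∧All≡⇒length≤1 : {A : Set} {f : A} {xs : List A} → Unique xs → All (_≡ f) xs → length xs ≤ 1
Unique∧All≡⇒length≤1 []             _                 = z≤n
Unique∧All≡⇒length≤1 ([] ∷ [])      _                 = s≤s z≤n
Unique∧All≡⇒length≤1 ((a≢b ∷ _) ∷ _) (a≡f ∷ b≡f ∷ _) = ⊥-elim (a≢b (trans a≡f (sym b≡f)))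

module _ {A : Set} where

  Ends-∷ : ∀ {a b z : A} {xs} → Ends b z xs → Ends a z (a ∷ xs)
  Ends-∷ e@(ends-1 _) = ends-∷ e
  Ends-∷ e@(ends-∷ _) = ends-∷ e

  Ends-++ : ∀ {a b c d : A} {xs ys} → Ends a b xs → Ends c d ys → Ends a d (xs ++ ys)
  Ends-++ (ends-1 refl) e  = Ends-∷ e
  Ends-++ (ends-∷ e₁)   e₂ = ends-∷ (Ends-++ e₁ e₂)

  Ends-reverse : ∀ {a b : A} {xs} → Ends a b xs → Ends b a (reverse xs)
  Ends-reverse (ends-1 refl) = ends-1 refl
  Ends-reverse {a} (ends-∷ {y} {ys} e) =
    subst (Ends _ a) (sym (unfold-reverse a (y ∷ ys))) (Ends-++ (Ends-reverse e) (ends-1 refl))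

  Ends⇒last∈ : ∀ {a b : A} {xs} → Ends a b xs → b ∈ xs
  Ends⇒last∈ (ends-1 refl) = here refl
  Ends⇒last∈ (ends-∷ e)    = there (Ends⇒last∈ e)

  record Split {ℓ} (R : Rel A ℓ) (a z : A) (xs : List A) : Set ℓ where
    constructor split
    field
      front back : List A
      {p q}      : A
      xs≡        : xs ≡ front ++ back
      front-ends : Ends a p front
      back-ends  : Ends q z back
      related    : R p q

  Split-∷ : ∀ {ℓ} {R : Rel A ℓ} {a b z xs} → Split R b z xs → Split R a z (a ∷ xs)
  Split-∷ (split front back eq fe be r) = split (_ ∷ front) back (cong (_ ∷_) eq) (Ends-∷ fe) be r

  split-or-linked : ∀ {ℓ} {R : Rel A ℓ} {a z xs} → B.Decidable R → Ends a z xs →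
                    Split R a z xs ⊎ Linked (λ p q → ¬ R p q) xs
  split-or-linked R? (ends-1 refl) = inj₂ [-]
  split-or-linked {a = a} R? (ends-∷ {y} e) with R? a y
  ... | yes r  = inj₁ (split (a ∷ []) _ refl (ends-1 refl) e r)
  ... | no ¬r  = Sum.map Split-∷ (¬r ∷_) (split-or-linked R? e)

+-suc-≤ : ∀ {m n o p} → m + n ≤ o + p → m + suc n ≤ o + suc p
+-suc-≤ {m} {n} {o} {p} h = subst₂ _≤_ (sym (+-suc m n)) (sym (+-suc o p)) (s≤s h)

module _ {A : Set} {ℓ} {X Y : Pred A ℓ} (X? : Decidable X) (Y? : Decidable Y) where

  length-filter-+-≤ : ∀ xs → length (filter X? xs) + length (filter Y? xs) ≤
                             length xs + length (filter (X? ∩? Y?) xs)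
  length-filter-+-≤ []       = z≤n
  length-filter-+-≤ (a ∷ as) with X? a | Y? a | length-filter-+-≤ as
  ... | yes _ | yes _ | ih = s≤s (+-suc-≤ ih)
  ... | yes _ | no  _ | ih = s≤s ih
  ... | no  _ | yes _ | ih = ≤-trans (≤-reflexive (+-suc _ _)) (s≤s ih)
  ... | no  _ | no  _ | ih = m≤n⇒m≤1+n ih

  Uncrossed : List A → Set ℓ
  Uncrossed = Linked (λ p q → ¬ (X p × Y q))

  length-filter-drop-+-≤-uncrossed : ∀ {a z xs} → Ends a z xs → Uncrossed xs → ¬ X z →
                                     length (filter X? xs) + length (filter Y? (drop 1 xs)) ≤ length (drop 1 xs)
  length-filter-drop-+-≤-uncrossed {a} (ends-1 refl) [-] ¬Xz with X? a
  ... | yes Xa = ⊥-elim (¬Xz Xa)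
  ... | no  _  = z≤n
  length-filter-drop-+-≤-uncrossed {a} (ends-∷ {b} e) (¬XaYb ∷ l) ¬Xz
    with X? a | Y? b | length-filter-drop-+-≤-uncrossed e l ¬Xz
  ... | yes Xa | yes Yb | _  = ⊥-elim (¬XaYb (Xa , Yb))
  ... | yes _  | no  _  | ih = s≤s ih
  ... | no  _  | yes _  | ih = ≤-trans (≤-reflexive (+-suc _ _)) (s≤s ih)
  ... | no  _  | no  _  | ih = m≤n⇒m≤1+n ih

  length-filter-+-≤-uncrossed : ∀ {a z xs} → Ends a z xs → Uncrossed xs → ¬ X z →
                                length (filter X? xs) + length (filter Y? xs) ≤ length xs
  length-filter-+-≤-uncrossed {xs = b ∷ _} e l ¬Xz with Y? b
  ... | yes _ = ≤-trans (≤-reflexive (+-suc _ _)) (s≤s (length-filter-drop-+-≤-uncrossed e l ¬Xz))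
  ... | no  _ = m≤n⇒m≤1+n (length-filter-drop-+-≤-uncrossed e l ¬Xz)

module _ {n : ℕ} where

  open import Data.List.Membership.DecPropositional (_≟_ {n}) using (_∈?_; _∉?_)

  complement : List (Fin n) → List (Fin n)
  complement xs = filter (_∉? xs) (allFin n)

  allFin-↭-++-complement : ∀ {xs} → Unique xs → allFin n ↭ xs ++ complement xs
  allFin-↭-++-complement {xs} xs! = ∼bag⇒↭ (unique∧set⇒bag
    (Unique.allFin⁺ n)
    (Unique.++⁺ xs! (Unique.filter⁺ (_∉? xs) (Unique.allFin⁺ n))
      λ (w∈xs , w∈c) → proj₂ (∈-filter⁻ (_∉? xs) {xs = allFin n} w∈c) w∈xs)
    (λ {w} → mk⇔ (λ _ → into w) (λ _ → ∈-allFin w)))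
    where
    into : ∀ w → w ∈ xs ++ complement xs
    into w with w ∈? xs
    ... | yes w∈xs = ∈-++⁺ˡ w∈xs
    ... | no  w∉xs = ∈-++⁺ʳ xs (∈-filter⁺ (_∉? xs) (∈-allFin w) w∉xs)

  length-++-complement : ∀ {xs} → Unique xs → length xs + length (complement xs) ≡ n
  length-++-complement {xs} xs! = begin
    length xs + length (complement xs) ≡⟨ length-++ xs ⟨
    length (xs ++ complement xs)       ≡⟨ ↭-length (allFin-↭-++-complement xs!) ⟨
    length (allFin n)                  ≡⟨ length-tabulate id ⟩
    n                                  ∎
    where open ≡-Reasoning

  length-filter-allFin : ∀ {p} {P : Pred (Fin n) p} (P? : Decidable P) {xs} → Unique xs →
    length (filter P? (allFin n)) ≡ length (filter P? xs) + length (filter P? (complement xs))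
  length-filter-allFin P? {xs} xs! = begin
    length (filter P? (allFin n))                     ≡⟨ ↭-length (filter-↭ P? (allFin-↭-++-complement xs!)) ⟩
    length (filter P? (xs ++ complement xs))          ≡⟨ cong length (filter-++ P? xs (complement xs)) ⟩
    length (filter P? xs ++ filter P? (complement xs)) ≡⟨ length-++ (filter P? xs) ⟩
    length (filter P? xs) + length (filter P? (complement xs)) ∎
    where open ≡-Reasoning

n+1≤2a⇒n+1≤2b⇒n<a+b : ∀ {n a b} → n + 1 ≤ 2 * a → n + 1 ≤ 2 * b → n < a + b
n+1≤2a⇒n+1≤2b⇒n<a+b {n} {a} {b} 2a≥n+1 2b≥n+1 = subst (_≤ a + b) (+-comm n 1) (*-cancelˡ-≤ 2 (begin
  2 * (n + 1)           ≡⟨ cong (n + 1 +_) (+-identityʳ (n + 1)) ⟩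
  (n + 1) + (n + 1)     ≤⟨ +-mono-≤ 2a≥n+1 2b≥n+1 ⟩
  2 * a + 2 * b         ≡⟨ *-distribˡ-+ 2 a b ⟨
  2 * (a + b)           ∎))
  where open ≤-Reasoning

module _ {n : ℕ} (G : Graph n) where

  open import Data.List.Membership.DecPropositional (_≟_ {n}) using (_∈?_; _∉?_)

  adj-sym : ∀ {a b} → T (adj G a b) → T (adj G b a)
  adj-sym {a} {b} = subst T (symmetric G a b)

  adj-irrefl : ∀ {a} → ¬ T (adj G a a)
  adj-irrefl {a} = subst T (loopless G a)

  adj⇒≢ : ∀ {a b} → T (adj G a b) → a ≢ b
  adj⇒≢ a~b refl = adj-irrefl a~b

  Walk-∷ : ∀ {a c d ys} → T (adj G a c) → Ends c d ys → Walk G ys → Walk G (a ∷ ys)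
  Walk-∷ a~c (ends-1 refl) w = walk-∷ _ _ a~c w
  Walk-∷ a~c (ends-∷ _)    w = walk-∷ _ _ a~c w

  Walk-++ : ∀ {a b c d xs ys} → Ends a b xs → Walk G xs → T (adj G b c) → Ends c d ys → Walk G ys →
            Walk G (xs ++ ys)
  Walk-++ (ends-1 refl) _                  b~c e w = Walk-∷ b~c e w
  Walk-++ (ends-∷ e₁)   (walk-∷ _ _ t w₁) b~c e w = walk-∷ _ _ t (Walk-++ e₁ w₁ b~c e w)

  Walk-tail : ∀ {a ys} → Walk G (a ∷ ys) → Walk G ys
  Walk-tail (walk-[x] _)     = walk-[]
  Walk-tail (walk-∷ _ _ _ w) = w

  Walk-++⁻ : ∀ xs {ys} → Walk G (xs ++ ys) → Walk G xs × Walk G ys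
  Walk-++⁻ []           w                = walk-[] , w
  Walk-++⁻ (a ∷ [])     w                = walk-[x] a , Walk-tail w
  Walk-++⁻ (a ∷ b ∷ xs) (walk-∷ _ _ t w) with Walk-++⁻ (b ∷ xs) w
  ... | w₁ , w₂ = walk-∷ a b t w₁ , w₂

  Walk-reverse : ∀ {a b xs} → Ends a b xs → Walk G xs → Walk G (reverse xs)
  Walk-reverse (ends-1 refl) w = w
  Walk-reverse {a} (ends-∷ {y} {ys} e) (walk-∷ _ _ a~y w) =
    subst (Walk G) (sym (unfold-reverse a (y ∷ ys)))
      (Walk-++ (Ends-reverse e) (Walk-reverse e w) (adj-sym a~y) (ends-1 refl) (walk-[x] a))

  trivial-path : ∀ u → Path G u u
  trivial-path u = record
    { vertices = u ∷ [] ; isWalk = walk-[x] u ; distinct = [] ∷ [] ; ends = ends-1 refl }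

  Path-∷ʳ : ∀ {u x y} (P : Path G u x) → y ∉ vertices P → T (adj G x y) → Path G u y
  Path-∷ʳ {y = y} P y∉P x~y = record
    { vertices = vertices P ∷ʳ y
    ; isWalk   = Walk-++ (ends P) (isWalk P) x~y (ends-1 refl) (walk-[x] y)
    ; distinct = Unique.++⁺ (distinct P) ([] ∷ []) λ { (y∈P , here refl) → y∉P y∈P }
    ; ends     = Ends-++ (ends P) (ends-1 refl)
    }

  Crossing : Fin n → Fin n → Fin n → Fin n → Set
  Crossing x y p q = T (adj G x p) × T (adj G y q)

  crossing? : ∀ x y → B.Decidable (Crossing x y)
  crossing? x y p q = T? (adj G x p) ×-dec T? (adj G y q)

  -- Pósa rotation: u…p q…x with x ∼ p becomes the path u…p x…q.
  rotate : ∀ {u x y} (P : Path G u x) (s : Split (Crossing x y) u x (vertices P)) →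
           Σ (Path G u (Split.q s)) λ Q → vertices Q ↭ vertices P
  rotate P (split front back eq front-ends back-ends (x~p , _))
    with Walk-++⁻ front (subst (Walk G) eq (isWalk P))
  ... | front-walk , back-walk = record
    { vertices = front ++ reverse back
    ; isWalk   = Walk-++ front-ends front-walk (adj-sym x~p) (Ends-reverse back-ends)
                   (Walk-reverse back-ends back-walk)
    ; distinct = Unique-resp-↭ (↭-sym rotated↭P) (distinct P)
    ; ends     = Ends-++ front-ends (Ends-reverse back-ends)
    } , rotated↭P
    where
    rotated↭P : front ++ reverse back ↭ vertices P
    rotated↭P = ↭-trans (++⁺ˡ front (↭-reverse back)) (↭-reflexive (sym eq))

  degree-+-≤ : ∀ {u x y f} (P : Path G u x) → ¬ T (adj G x y) → y ∉ vertices P →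
               Linked (λ p q → ¬ Crossing x y p q) (vertices P) →
               (∀ {z} → z ∉ vertices P → T (adj G x z) → T (adj G y z) → z ≡ f) →
               degree G x + degree G y ≤ n
  degree-+-≤ {x = x} {y} {f} P x≁y y∉P uncrossed detour⇒f = begin
    degree G x + degree G y
      ≡⟨ cong₂ _+_ (length-filter-allFin X? L!) (length-filter-allFin Y? L!) ⟩
    (#X L + #X C) + (#Y L + #Y C)
      ≡⟨ interchange +-commutativeSemigroup (#X L) (#X C) (#Y L) (#Y C) ⟩
    (#X L + #Y L) + (#X C + #Y C)
      ≤⟨ +-mono-≤ on-path off-path ⟩
    length (vertices P) + suc (length C)
      ≡⟨ +-suc (length (vertices P)) (length C) ⟩
    length L + length C
      ≡⟨ length-++-complement L! ⟩
    n ∎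
    where
    open ≤-Reasoning
    X? : Decidable (T ∘ adj G x)
    X? w = T? (adj G x w)
    Y? : Decidable (T ∘ adj G y)
    Y? w = T? (adj G y w)
    #X #Y : List (Fin n) → ℕ
    #X xs = length (filter X? xs)
    #Y xs = length (filter Y? xs)
    -- y, adjacent to neither x nor y, is counted with the path: this pays for f, the one vertex
    -- off the path that may be adjacent to both.
    L C : List (Fin n)
    L = y ∷ vertices P
    C = complement L
    L! : Unique L
    L! = ¬Any⇒All¬ (vertices P) y∉P ∷ distinct P

    on-path : #X L + #Y L ≤ length (vertices P)
    on-path rewrite filter-reject X? {xs = vertices P} x≁y | filter-reject Y? {xs = vertices P} adj-irrefl =
      length-filter-+-≤-uncrossed X? Y? (ends P) uncrossed adj-irrefl

    common-is-f : All (_≡ f) (filter (X? ∩? Y?) C)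
    common-is-f = All.tabulate λ w∈ → let (w∈C , x~w , y~w) = ∈-filter⁻ (X? ∩? Y?) {xs = C} w∈ in
      detour⇒f (proj₂ (∈-filter⁻ (_∉? L) {xs = allFin n} w∈C) ∘ there) x~w y~w

    off-path : #X C + #Y C ≤ suc (length C)
    off-path = ≤-trans (length-filter-+-≤ X? Y? C) (≤-trans
      (+-monoʳ-≤ (length C) (Unique∧All≡⇒length≤1 common! common-is-f))
      (≤-reflexive (+-comm (length C) 1)))
      where
      common! : Unique (filter (X? ∩? Y?) C)
      common! = Unique.filter⁺ (X? ∩? Y?) (Unique.filter⁺ (_∉? L) (Unique.allFin⁺ n))

  record Extension {u x} (P : Path G u x) (y f : Fin n) : Set where
    field
      extended : Path G u y
      keeps    : ∀ {w} → w ∈ vertices P → w ∈ vertices extended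
      avoids   : f ∈ vertices extended → f ∈ vertices P ⊎ f ≡ y

  extension : ∀ {u x y f} {P : Path G u x} (Q : Path G u y) (zs : List (Fin n)) → f ∉ zs →
              vertices Q ↭ vertices P ++ zs ++ y ∷ [] → Extension P y f
  extension {y = y} {f} {P} Q zs f∉zs Q↭ = record
    { extended = Q
    ; keeps    = λ w∈P → ∈-resp-↭ (↭-sym Q↭) (∈-++⁺ˡ w∈P)
    ; avoids   = λ f∈Q → Sum.map₂ new-is-y (∈-++⁻ (vertices P) (∈-resp-↭ Q↭ f∈Q))
    }
    where
    new-is-y : f ∈ zs ++ y ∷ [] → f ≡ y
    new-is-y f∈ with ∈-++⁻ zs f∈
    ... | inj₁ f∈zs      = ⊥-elim (f∉zs f∈zs)
    ... | inj₂ (here eq) = eq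

  extend : ∀ {u x y} (P : Path G u x) → HighDeg G x → HighDeg G y → y ∉ vertices P → (f : Fin n) →
           Extension P y f
  extend {x = x} {y} P hx hy y∉P f with T? (adj G x y)
  ... | yes x~y = extension (Path-∷ʳ P y∉P x~y) [] (λ ()) ↭-refl
  ... | no  x≁y with any? (λ z → (z ∉? vertices P) ×-dec ¬? (z ≟ f) ×-dec T? (adj G x z) ×-dec T? (adj G y z))
  ...   | yes (z , z∉P , z≢f , x~z , y~z) =
    extension (Path-∷ʳ (Path-∷ʳ P z∉P x~z) y∉P∷ʳz (adj-sym y~z)) (z ∷ []) (λ { (here refl) → z≢f refl })
      (↭-reflexive (++-assoc (vertices P) (z ∷ []) (y ∷ [])))
    where
    y∉P∷ʳz : y ∉ vertices P ∷ʳ z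
    y∉P∷ʳz y∈ with ∈-++⁻ (vertices P) y∈
    ... | inj₁ y∈P        = y∉P y∈P
    ... | inj₂ (here y≡z) = adj⇒≢ y~z y≡z
  ...   | no no-detour with split-or-linked (crossing? x y) (ends P)
  ...     | inj₁ s with rotate P s
  ...       | Q , Q↭P = extension (Path-∷ʳ Q (y∉P ∘ ∈-resp-↭ Q↭P) (adj-sym (proj₂ (Split.related s)))) []
                          (λ ()) (++⁺ʳ (y ∷ []) Q↭P)
  extend {x = x} {y} P hx hy y∉P f | no x≁y | no no-detour | inj₂ uncrossed =
    ⊥-elim (<⇒≱ (n+1≤2a⇒n+1≤2b⇒n<a+b {a = degree G x} {b = degree G y} hx hy)
                (degree-+-≤ P x≁y y∉P uncrossed detour⇒f))
    where
    detour⇒f : ∀ {z} → z ∉ vertices P → T (adj G x z) → T (adj G y z) → z ≡ f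
    detour⇒f {z} z∉P x~z y~z = decidable-stable (z ≟ f) λ z≢f → no-detour (z , z∉P , z≢f , x~z , y~z)

  record PartialCover (u v : Fin n) (ws : List (Fin n)) : Set where
    field
      end       : Fin n
      end-high  : HighDeg G end
      path      : Path G u end
      v∉path    : v ∉ vertices path
      covers    : ∀ {w} → w ∈ ws → HighDeg G w → w ≢ v → w ∈ vertices path

  partial-cover : ∀ {u v} → u ≢ v → HighDeg G u → (ws : List (Fin n)) → PartialCover u v ws
  partial-cover {u} u≢v hu [] = record
    { end = u ; end-high = hu ; path = trivial-path u ; v∉path = λ { (here v≡u) → u≢v (sym v≡u) } ; covers = λ () }
  partial-cover {v = v} u≢v hu (w ∷ ws) with partial-cover u≢v hu ws
  ... | c with (n + 1 ≤? 2 * degree G w) ×-dec ¬? (w ≟ v) ×-dec (w ∉? vertices (PartialCover.path c))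
  ...   | yes (hw , w≢v , w∉P) = record
    { end = w ; end-high = hw ; path = extended ; v∉path = v∉extended ; covers = covers′ }
    where
    open PartialCover c using (end-high; path; v∉path; covers)
    open Extension (extend path end-high hw w∉P v)
    v∉extended : v ∉ vertices extended
    v∉extended v∈ with avoids v∈
    ... | inj₁ v∈P = v∉path v∈P
    ... | inj₂ v≡w = w≢v (sym v≡w)
    covers′ : ∀ {w′} → w′ ∈ w ∷ ws → HighDeg G w′ → w′ ≢ v → w′ ∈ vertices extended
    covers′ (here refl) _ _ = Ends⇒last∈ (ends extended)
    covers′ (there w′∈ws) hw′ w′≢v = keeps (covers w′∈ws hw′ w′≢v)
  ...   | no ¬new = record
    { end = end ; end-high = end-high ; path = path ; v∉path = v∉path ; covers = covers′ }
    where
    open PartialCover c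
    covers′ : ∀ {w′} → w′ ∈ w ∷ ws → HighDeg G w′ → w′ ≢ v → w′ ∈ vertices path
    covers′ (here refl) hw w≢v = decidable-stable (w ∈? vertices path) λ w∉P → ¬new (hw , w≢v , w∉P)
    covers′ (there w′∈ws) = covers w′∈ws

theorem1p5 : (n : ℕ) (G : Graph n) (u v : Fin n) → u ≢ v →
    HighDeg G u → HighDeg G v →
    Σ (Path G u v) (λ P → (w : Fin n) → HighDeg G w → w ∈ vertices P)
theorem1p5 n G u v u≢v hu hv = extended , covers-all
  where
  open PartialCover (partial-cover G u≢v hu (allFin n))
  open Extension (extend G path end-high hv v∉path v)
  covers-all : (w : Fin n) → HighDeg G w → w ∈ vertices extended
  covers-all w hw with w ≟ v
  ... | yes refl = Ends⇒last∈ (ends extended)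
  ... | no  w≢v  = keeps (covers (∈-allFin w) hw w≢v)
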